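{- For every $L$-code $C\subseteq L^n$, $$\mathrm{W}_{\sigma(C)}(u,v)=\mathrm{swe}_C(u^2+v^2,\ 2uv,\ 2v^2).$$
   Context: Let $L=\{0,1,\omega,\bar\omega\}$ and $K=\{0,a,b,c\}$ both denote the Klein four-group $\mathbf{Z}_2\times\mathbf{Z}_2$. An $L$-code of length $n$ is a subgroup of $L^n$; a Kleinian code of length $m$ is a subgroup of $K^m$. Let $\widetilde{\ }:L^n\to K^{2n}$ be the map sending $(c_1,\dots,c_n)$ to the concatenation of the pairs given by $0\mapsto(0,0)$, $1\mapsto(0,a)$, $\omega\mapsto(b,b)$, $\bar\omega\mapsto(b,c)$, and let $\delta_2^n=\{(0,0),(a,a)\}^n\subseteq K^{2n}$. Define $\sigma(C)=\widetilde{C}+\delta_2^n\subseteq K^{2n}$. For a Kleinian code $E\subseteq K^m$, $\mathrm{W}_E(u,v)=\sum_{\mathbf{e}\in E}u^{m-\mathrm{wt}(\mathbf{e})}v^{\mathrm{wt}(\mathbf{e})}$ where $\mathrm{wt}$ is the number of nonzero coordinates. For an $L$-code $C$, $\mathrm{swe}_C(x,y,z)=\sum_{\mathbf{c}\in C}x^{n_0(\mathbf{c})}y^{n_1(\mathbf{c})}z^{n_2(\mathbf{c})}$, with $n_0,n_1,n_2$ the numbers of coordinates equal to $0$, to $1$, and to $\omega$ or $\bar\omega$. -}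

module Defs where

open import Level using (Level; _⊔_)
open import Data.Nat using (ℕ; zero; suc; _∸_) renaming (_*_ to _*ℕ_)
open import Data.Product using (Σ; _×_; ∃-syntax)
open import Data.List using (List; []; _∷_; filter; map; concatMap)
open import Data.Vec using (Vec; []; _∷_; replicate; zipWith)
open import Relation.Unary using (Pred; Decidable)
open import Relation.Binary.PropositionalEquality using (_≡_)
open import Algebra.Bundles using (CommutativeSemiring)

-- The Klein four-group in two notations

data L : Set where
  0L 1L ω ω̄ : L

_+L_ : L → L → L
0L +L y  = y
x  +L 0L = x
1L +L 1L = 0L
1L +L ω  = ω̄
1L +L ω̄  = ω
ω  +L 1L = ω̄
ω  +L ω  = 0L
ω  +L ω̄  = 1L
ω̄  +L 1L = ω
ω̄  +L ω  = 1L
ω̄  +L ω̄  = 0L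

data K : Set where
  0K a b c : K

_+K_ : K → K → K
0K +K y  = y
x  +K 0K = x
a  +K a  = 0K
a  +K b  = c
a  +K c  = b
b  +K a  = c
b  +K b  = 0K
b  +K c  = a
c  +K a  = b
c  +K b  = a
c  +K c  = 0K

-- Codes: subgroups of L^n (every element is its own inverse, so a
-- subgroup is a subset containing 0 and closed under addition).
-- Membership is required to be decidable (always true for finite sets,
-- needed to form finite sums constructively).

record LCode (n : ℕ) : Set₁ where
  field
    member  : Vec L n → Set
    member? : Decidable member
    zero∈   : member (replicate n 0L)
    closed  : ∀ x y → member x → member y → member (zipWith _+L_ x y)
open LCode public

pairOf : L → K × K
pairOf 0L = 0K Data.Product., 0K
pairOf 1L = 0K Data.Product., a
pairOf ω  = b Data.Product., b
pairOf ω̄  = b Data.Product., c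

tilde : ∀ {n} → Vec L n → Vec K (n *ℕ 2)
tilde [] = []
tilde (x ∷ xs) with pairOf x
... | p Data.Product., q = p ∷ q ∷ tilde xs

data Δ : ∀ n → Vec K (n *ℕ 2) → Set where
  Δ[]  : Δ zero []
  Δ00  : ∀ {n d} → Δ n d → Δ (suc n) (0K ∷ 0K ∷ d)
  Δaa  : ∀ {n d} → Δ n d → Δ (suc n) (a ∷ a ∷ d)

σ : ∀ {n} → LCode n → Vec K (n *ℕ 2) → Set
σ {n} C e = ∃[ x ] ∃[ d ] (member C x × Δ n d × e ≡ zipWith _+K_ (tilde x) d)

wt : ∀ {m} → Vec K m → ℕ
wt [] = 0
wt (0K ∷ xs) = wt xs
wt (_  ∷ xs) = suc (wt xs)

n0 n1 n2 : ∀ {n} → Vec L n → ℕ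
n0 [] = 0
n0 (0L ∷ xs) = suc (n0 xs)
n0 (_  ∷ xs) = n0 xs
n1 [] = 0
n1 (1L ∷ xs) = suc (n1 xs)
n1 (_  ∷ xs) = n1 xs
n2 [] = 0
n2 (ω  ∷ xs) = suc (n2 xs)
n2 (ω̄  ∷ xs) = suc (n2 xs)
n2 (_  ∷ xs) = n2 xs

allVecs : ∀ {A : Set} → List A → (n : ℕ) → List (Vec A n)
allVecs xs zero = [] ∷ []
allVecs xs (suc n) = concatMap (λ x → map (x ∷_) (allVecs xs n)) xs

allL : List L
allL = 0L ∷ 1L ∷ ω ∷ ω̄ ∷ []

allK : List K
allK = 0K ∷ a ∷ b ∷ c ∷ []

-- Enumerators, evaluated in an arbitrary commutative semiring
-- (an identity of polynomials with ℕ-coefficients holds iff it holds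
-- under every evaluation in every commutative semiring).

module Enumerators {s ℓ : Level} (R : CommutativeSemiring s ℓ) where
  open CommutativeSemiring R

  pow : Carrier → ℕ → Carrier
  pow x zero = 1#
  pow x (suc k) = x * pow x k

  sumL : List Carrier → Carrier
  sumL [] = 0#
  sumL (x ∷ xs) = x + sumL xs

  W : ∀ {m} (E : Vec K m → Set) → Decidable E → Carrier → Carrier → Carrier
  W {m} E E? u v =
    sumL (map (λ e → pow u (m ∸ wt e) * pow v (wt e)) (filter E? (allVecs allK m)))

  swe : ∀ {n} → LCode n → Carrier → Carrier → Carrier → Carrier
  swe {n} C x y z =
    sumL (map (λ w → pow x (n0 w) * (pow y (n1 w) * pow z (n2 w)))
              (filter (member? C) (allVecs allL n)))

module Submission where

-- Every word e ∈ K^{2n} lies in at most one coset ~x + δ₂ⁿ, and reading e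
-- off pair by pair recovers x: the pairs decoding to the letters 0, 1, ω, ω̄
-- are {00,aa}, {0a,a0}, {bb,cc}, {bc,cb}, and all other pairs decode to
-- nothing.  So σ(C) is the set of words whose decoding lies in C.
--
-- With the K-monomial κ(e) = ∏ (u if eᵢ = 0 else v), summing κ over the
-- pairs decoding to a letter l gives
--   u²+v² (l = 0),  2uv (l = 1),  2v² (l = ω, ω̄),
-- i.e. exactly the substitution of the theorem.  By induction on n, the sum
-- of g(decode e)·κ(e) over all e ∈ K^{2n} equals the sum over x ∈ L^n of
-- g(x)·∏ λ(xᵢ) with λ the substituted letter weights ('pushforward').
-- Taking g = indicator of C, and rewriting both enumerator monomials as
-- coordinatewise products, yields the theorem.

open import Defs
open import Data.Nat using (ℕ)
open import Relation.Unary using (Decidable)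
open import Algebra.Bundles using (CommutativeSemiring)

open import Level using (Level)
open import Data.Nat using (zero; suc; _∸_; _≤_; z≤n; s≤s) renaming (_*_ to _*ℕ_)
open import Data.Nat.Properties using (+-∸-assoc; m≤n⇒m≤1+n)
open import Data.Product using (_×_; _,_; ∃-syntax)
open import Data.List using (List; []; _∷_; map; filter; concatMap; _++_)
open import Data.List.Properties using (map-∘)
open import Data.Vec using (Vec; []; _∷_; zipWith)
open import Data.Maybe using (Maybe; just; nothing; _>>=_) renaming (map to mapMaybe)
open import Relation.Nullary using (Dec; yes; no; contradiction)
open import Relation.Binary.PropositionalEquality using (_≡_; refl; cong; sym)

-- Decoding one coordinate pair: the coset ~l + {(0,0),(a,a)} decodes to l.
decodePair : K → K → Maybe L
decodePair 0K 0K = just 0L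
decodePair a  a  = just 0L
decodePair 0K a  = just 1L
decodePair a  0K = just 1L
decodePair b  b  = just ω
decodePair c  c  = just ω
decodePair b  c  = just ω̄
decodePair c  b  = just ω̄
decodePair _  _  = nothing

decode : ∀ n → Vec K (n *ℕ 2) → Maybe (Vec L n)
decode zero    []          = just []
decode (suc n) (p ∷ q ∷ e) = decodePair p q >>= λ l → mapMaybe (l ∷_) (decode n e)

decode-encoding : ∀ {n} (x : Vec L n) {d} → Δ n d →
                  decode n (zipWith _+K_ (tilde x) d) ≡ just x
decode-encoding []       Δ[]     = refl
decode-encoding (0L ∷ x) (Δ00 δ) = cong (mapMaybe (0L ∷_)) (decode-encoding x δ)
decode-encoding (1L ∷ x) (Δ00 δ) = cong (mapMaybe (1L ∷_)) (decode-encoding x δ)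
decode-encoding (ω  ∷ x) (Δ00 δ) = cong (mapMaybe (ω ∷_))  (decode-encoding x δ)
decode-encoding (ω̄  ∷ x) (Δ00 δ) = cong (mapMaybe (ω̄ ∷_))  (decode-encoding x δ)
decode-encoding (0L ∷ x) (Δaa δ) = cong (mapMaybe (0L ∷_)) (decode-encoding x δ)
decode-encoding (1L ∷ x) (Δaa δ) = cong (mapMaybe (1L ∷_)) (decode-encoding x δ)
decode-encoding (ω  ∷ x) (Δaa δ) = cong (mapMaybe (ω ∷_))  (decode-encoding x δ)
decode-encoding (ω̄  ∷ x) (Δaa δ) = cong (mapMaybe (ω̄ ∷_))  (decode-encoding x δ)

Encodes : ∀ n → Vec K (n *ℕ 2) → Vec L n → Set
Encodes n e x = ∃[ d ] (Δ n d × e ≡ zipWith _+K_ (tilde x) d)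

encodes-cons : ∀ {n e x} p q {l} → decodePair p q ≡ just l →
               Encodes n e x → Encodes (suc n) (p ∷ q ∷ e) (l ∷ x)
encodes-cons 0K 0K refl (_ , δ , refl) = _ , Δ00 δ , refl
encodes-cons a  a  refl (_ , δ , refl) = _ , Δaa δ , refl
encodes-cons 0K a  refl (_ , δ , refl) = _ , Δ00 δ , refl
encodes-cons a  0K refl (_ , δ , refl) = _ , Δaa δ , refl
encodes-cons b  b  refl (_ , δ , refl) = _ , Δ00 δ , refl
encodes-cons c  c  refl (_ , δ , refl) = _ , Δaa δ , refl
encodes-cons b  c  refl (_ , δ , refl) = _ , Δ00 δ , refl
encodes-cons c  b  refl (_ , δ , refl) = _ , Δaa δ , refl
encodes-cons 0K b  () _
encodes-cons 0K c  () _
encodes-cons a  b  () _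
encodes-cons a  c  () _
encodes-cons b  0K () _
encodes-cons b  a  () _
encodes-cons c  0K () _
encodes-cons c  a  () _

decode-sound : ∀ n (e : Vec K (n *ℕ 2)) {x} → decode n e ≡ just x → Encodes n e x
decode-sound zero [] refl = [] , Δ[] , refl
decode-sound (suc n) (p ∷ q ∷ e) eq with decodePair p q in pq | decode n e in de
... | just l | just x' with refl ← eq = encodes-cons p q pq (decode-sound n e de)
decode-sound (suc n) (p ∷ q ∷ e) () | nothing | _
decode-sound (suc n) (p ∷ q ∷ e) () | just l  | nothing

σ⇒decode : ∀ {n} (C : LCode n) {e} → σ C e → ∃[ x ] (decode n e ≡ just x × member C x)
σ⇒decode C (x , d , x∈C , δ , refl) = x , decode-encoding x δ , x∈C

decode⇒σ : ∀ {n} (C : LCode n) {e x} → decode n e ≡ just x → member C x → σ C e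
decode⇒σ C {e} {x} eq x∈C with decode-sound _ e eq
... | d , δ , e≡ = x , d , x∈C , δ , e≡

wt≤length : ∀ {m} (e : Vec K m) → wt e ≤ m
wt≤length []       = z≤n
wt≤length (0K ∷ e) = m≤n⇒m≤1+n (wt≤length e)
wt≤length (a  ∷ e) = s≤s (wt≤length e)
wt≤length (b  ∷ e) = s≤s (wt≤length e)
wt≤length (c  ∷ e) = s≤s (wt≤length e)

module Enumeration {s ℓ : Level} (R : CommutativeSemiring s ℓ) where
  open CommutativeSemiring R renaming (refl to ≈-refl; sym to ≈-sym; trans to ≈-trans)
  open Enumerators R
  open import Relation.Binary.Reasoning.Setoid setoid
  open import Algebra.Properties.CommutativeSemigroup *-commutativeSemigroup using (x∙yz≈y∙xz)
  open import Algebra.Solver.Ring.NaturalCoefficients.Default R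

  sumOver : ∀ {A : Set} → List A → (A → Carrier) → Carrier
  sumOver xs f = sumL (map f xs)
  infix 5 sumOver
  syntax sumOver xs (λ x → f) = ∑[ x ∈ xs ] f

  sum-cong : ∀ {A : Set} (xs : List A) {f g : A → Carrier} →
             (∀ x → f x ≈ g x) → sumOver xs f ≈ sumOver xs g
  sum-cong []       f≈g = ≈-refl
  sum-cong (x ∷ xs) f≈g = +-cong (f≈g x) (sum-cong xs f≈g)

  sum-zero : ∀ {A : Set} (xs : List A) → ∑[ x ∈ xs ] 0# ≈ 0#
  sum-zero []       = ≈-refl
  sum-zero (_ ∷ xs) = ≈-trans (+-identityˡ _) (sum-zero xs)

  sum-scale : ∀ {A : Set} (xs : List A) k (f : A → Carrier) →
              ∑[ x ∈ xs ] k * f x ≈ k * sumOver xs f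
  sum-scale []       k f = ≈-sym (zeroʳ k)
  sum-scale (x ∷ xs) k f = ≈-trans (+-congˡ (sum-scale xs k f)) (≈-sym (distribˡ k _ _))

  sum-++ : ∀ {A : Set} (xs ys : List A) (f : A → Carrier) →
           sumOver (xs ++ ys) f ≈ sumOver xs f + sumOver ys f
  sum-++ []       ys f = ≈-sym (+-identityˡ _)
  sum-++ (x ∷ xs) ys f = ≈-trans (+-congˡ (sum-++ xs ys f)) (≈-sym (+-assoc _ _ _))

  sum-concatMap : ∀ {A B : Set} (g : A → List B) (xs : List A) (f : B → Carrier) →
                  sumOver (concatMap g xs) f ≈ ∑[ x ∈ xs ] sumOver (g x) f
  sum-concatMap g []       f = ≈-refl
  sum-concatMap g (x ∷ xs) f =
    ≈-trans (sum-++ (g x) (concatMap g xs) f) (+-congˡ (sum-concatMap g xs f))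

  sum-allVecs : ∀ {A : Set} (xs : List A) n (f : Vec A (suc n) → Carrier) →
                sumOver (allVecs xs (suc n)) f ≈ ∑[ x ∈ xs ] ∑[ w ∈ allVecs xs n ] f (x ∷ w)
  sum-allVecs xs n f =
    ≈-trans (sum-concatMap (λ x → map (x ∷_) (allVecs xs n)) xs f)
            (sum-cong xs (λ x → reflexive (cong sumL (sym (map-∘ (allVecs xs n))))))

  𝟙 : ∀ {p} {P : Set p} → Dec P → Carrier
  𝟙 (yes _) = 1#
  𝟙 (no _)  = 0#

  sum-filter : ∀ {A : Set} {P : A → Set} (P? : Decidable P) (xs : List A) (f : A → Carrier) →
               sumOver (filter P? xs) f ≈ ∑[ x ∈ xs ] 𝟙 (P? x) * f x
  sum-filter P? []       f = ≈-refl
  sum-filter P? (x ∷ xs) f with P? x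
  ... | yes _ = +-cong (≈-sym (*-identityˡ _)) (sum-filter P? xs f)
  ... | no _  = ≈-trans (sum-filter P? xs f)
                        (≈-sym (≈-trans (+-congʳ (zeroˡ _)) (+-identityˡ _)))

  onJust : ∀ {A : Set} → Maybe A → (A → Carrier) → Carrier
  onJust nothing  f = 0#
  onJust (just x) f = f x

  onJust-map : ∀ {A B : Set} (g : A → B) (m : Maybe A) (f : B → Carrier) →
               onJust (mapMaybe g m) f ≡ onJust m (λ x → f (g x))
  onJust-map g nothing  f = refl
  onJust-map g (just x) f = refl

  onJust-cong : ∀ {A : Set} (m : Maybe A) {f g : A → Carrier} →
                (∀ x → f x ≈ g x) → onJust m f ≈ onJust m g
  onJust-cong nothing  f≈g = ≈-refl
  onJust-cong (just x) f≈g = f≈g x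

  onJust-scale : ∀ {A : Set} (m : Maybe A) k (f : A → Carrier) →
                 onJust m (λ x → k * f x) ≈ k * onJust m f
  onJust-scale nothing  k f = ≈-sym (zeroʳ k)
  onJust-scale (just x) k f = ≈-refl

  σ-indicator : ∀ {n} (C : LCode n) (σC? : Decidable (σ C)) (e : Vec K (n *ℕ 2)) r →
                𝟙 (σC? e) * r ≈ onJust (decode n e) (λ x → 𝟙 (member? C x) * r)
  σ-indicator C σC? e r with σC? e
  ... | yes σe with σ⇒decode C σe
  ...   | x , eq , x∈C rewrite eq with member? C x
  ...     | yes _   = ≈-refl
  ...     | no x∉C  = contradiction x∈C x∉C
  σ-indicator {n} C σC? e r | no ¬σe with decode n e in eq
  ...   | nothing = zeroˡ r
  ...   | just x with member? C x
  ...     | yes x∈C = contradiction (decode⇒σ C eq x∈C) ¬σe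
  ...     | no _    = ≈-refl

  module Monomials (u v : Carrier) where
    two : Carrier
    two = 1# + 1#

    κ : K → Carrier
    κ 0K = u
    κ _  = v

    monK : ∀ {m} → Vec K m → Carrier
    monK []      = 1#
    monK (k ∷ e) = κ k * monK e

    λL : L → Carrier
    λL 0L = u * u + v * v
    λL 1L = two * (u * v)
    λL ω  = two * (v * v)
    λL ω̄  = two * (v * v)

    monL : ∀ {n} → Vec L n → Carrier
    monL []      = 1#
    monL (l ∷ x) = λL l * monL x

    wt-monomial : ∀ {m} (e : Vec K m) → pow u (m ∸ wt e) * pow v (wt e) ≈ monK e
    wt-monomial []                = *-identityˡ 1#
    wt-monomial {suc m} (0K ∷ e) rewrite +-∸-assoc 1 (wt≤length e) =
      ≈-trans (*-assoc u _ _) (*-congˡ (wt-monomial e))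
    wt-monomial (a ∷ e) = ≈-trans (x∙yz≈y∙xz _ v _) (*-congˡ (wt-monomial e))
    wt-monomial (b ∷ e) = ≈-trans (x∙yz≈y∙xz _ v _) (*-congˡ (wt-monomial e))
    wt-monomial (c ∷ e) = ≈-trans (x∙yz≈y∙xz _ v _) (*-congˡ (wt-monomial e))

    swe-monomial : ∀ {n} (x : Vec L n) →
                   pow (λL 0L) (n0 x) * (pow (λL 1L) (n1 x) * pow (λL ω) (n2 x)) ≈ monL x
    swe-monomial []       = ≈-trans (*-identityˡ _) (*-identityˡ 1#)
    swe-monomial (0L ∷ x) = ≈-trans (*-assoc (λL 0L) _ _) (*-congˡ (swe-monomial x))
    swe-monomial (1L ∷ x) =
      ≈-trans (*-congˡ (*-assoc (λL 1L) _ _)) (≈-trans (x∙yz≈y∙xz _ _ _) (*-congˡ (swe-monomial x)))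
    swe-monomial (ω ∷ x)  =
      ≈-trans (*-congˡ (x∙yz≈y∙xz _ _ _)) (≈-trans (x∙yz≈y∙xz _ _ _) (*-congˡ (swe-monomial x)))
    swe-monomial (ω̄ ∷ x)  =
      ≈-trans (*-congˡ (x∙yz≈y∙xz _ _ _)) (≈-trans (x∙yz≈y∙xz _ _ _) (*-congˡ (swe-monomial x)))

    pair-identity : (S : L → Carrier) →
      ∑[ p ∈ allK ] ∑[ q ∈ allK ] onJust (decodePair p q) (λ l → (κ p * κ q) * S l)
        ≈ ∑[ l ∈ allL ] λL l * S l
    pair-identity S = solve 6
      (λ u v s₀ s₁ s₂ s₃ →
         ((u :* u) :* s₀ :+ ((u :* v) :* s₁ :+ (con 0 :+ (con 0 :+ con 0)))) :+
         (((v :* u) :* s₁ :+ ((v :* v) :* s₀ :+ (con 0 :+ (con 0 :+ con 0)))) :+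
         ((con 0 :+ (con 0 :+ ((v :* v) :* s₂ :+ ((v :* v) :* s₃ :+ con 0)))) :+
         ((con 0 :+ (con 0 :+ ((v :* v) :* s₃ :+ ((v :* v) :* s₂ :+ con 0)))) :+ con 0)))
       := (u :* u :+ v :* v) :* s₀ :+ ((con 2 :* (u :* v)) :* s₁ :+
          ((con 2 :* (v :* v)) :* s₂ :+ ((con 2 :* (v :* v)) :* s₃ :+ con 0))))
      ≈-refl u v (S 0L) (S 1L) (S ω) (S ω̄)

    pushforward : ∀ n (g : Vec L n → Carrier) →
      ∑[ e ∈ allVecs allK (n *ℕ 2) ] onJust (decode n e) (λ x → g x * monK e)
        ≈ ∑[ x ∈ allVecs allL n ] g x * monL x
    pushforward zero    g = ≈-refl
    pushforward (suc n) g = begin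
      ∑[ e ∈ allVecs allK (suc n *ℕ 2) ] F e
        ≈⟨ sum-allVecs allK _ F ⟩
      ∑[ p ∈ allK ] ∑[ w ∈ allVecs allK (suc (n *ℕ 2)) ] F (p ∷ w)
        ≈⟨ sum-cong allK (λ p → sum-allVecs allK _ (λ w → F (p ∷ w))) ⟩
      ∑[ p ∈ allK ] ∑[ q ∈ allK ] ∑[ e ∈ allVecs allK (n *ℕ 2) ] F (p ∷ q ∷ e)
        ≈⟨ sum-cong allK (λ p → sum-cong allK (pair-block p)) ⟩
      ∑[ p ∈ allK ] ∑[ q ∈ allK ] onJust (decodePair p q) (λ l → (κ p * κ q) * S l)
        ≈⟨ pair-identity S ⟩
      ∑[ l ∈ allL ] λL l * S l
        ≈⟨ sum-cong allL (λ l → ≈-sym (sum-scale (allVecs allL n) (λL l) (λ x → g (l ∷ x) * monL x))) ⟩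
      ∑[ l ∈ allL ] ∑[ x ∈ allVecs allL n ] λL l * (g (l ∷ x) * monL x)
        ≈⟨ sum-cong allL (λ l → sum-cong (allVecs allL n) (λ x → x∙yz≈y∙xz (λL l) (g (l ∷ x)) (monL x))) ⟩
      ∑[ l ∈ allL ] ∑[ x ∈ allVecs allL n ] g (l ∷ x) * monL (l ∷ x)
        ≈⟨ ≈-sym (sum-allVecs allL n (λ x → g x * monL x)) ⟩
      ∑[ x ∈ allVecs allL (suc n) ] g x * monL x ∎
      where
      F : Vec K (suc n *ℕ 2) → Carrier
      F e = onJust (decode (suc n) e) (λ x → g x * monK e)

      S : L → Carrier
      S l = ∑[ x ∈ allVecs allL n ] g (l ∷ x) * monL x

      pair-block : ∀ p q →
        ∑[ e ∈ allVecs allK (n *ℕ 2) ] F (p ∷ q ∷ e)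
          ≈ onJust (decodePair p q) (λ l → (κ p * κ q) * S l)
      pair-block p q with decodePair p q
      ... | nothing = sum-zero (allVecs allK (n *ℕ 2))
      ... | just l  = begin
        ∑[ e ∈ allVecs allK (n *ℕ 2) ]
          onJust (mapMaybe (l ∷_) (decode n e)) (λ x → g x * (κ p * (κ q * monK e)))
          ≈⟨ sum-cong (allVecs allK (n *ℕ 2)) (λ e →
               ≈-trans (reflexive (onJust-map (l ∷_) (decode n e) _))
                       (onJust-cong (decode n e) (λ x → regroup (g (l ∷ x)) (monK e)))) ⟩
        ∑[ e ∈ allVecs allK (n *ℕ 2) ]
          onJust (decode n e) (λ x → (κ p * κ q) * (g (l ∷ x) * monK e))
          ≈⟨ sum-cong (allVecs allK (n *ℕ 2)) (λ e → onJust-scale (decode n e) _ _) ⟩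
        ∑[ e ∈ allVecs allK (n *ℕ 2) ]
          (κ p * κ q) * onJust (decode n e) (λ x → g (l ∷ x) * monK e)
          ≈⟨ sum-scale (allVecs allK (n *ℕ 2)) (κ p * κ q) _ ⟩
        (κ p * κ q) * (∑[ e ∈ allVecs allK (n *ℕ 2) ] onJust (decode n e) (λ x → g (l ∷ x) * monK e))
          ≈⟨ *-congˡ (pushforward n (λ x → g (l ∷ x))) ⟩
        (κ p * κ q) * S l ∎
        where
        regroup : ∀ y m → y * (κ p * (κ q * m)) ≈ (κ p * κ q) * (y * m)
        regroup y m = ≈-trans (*-congˡ (≈-sym (*-assoc _ _ _))) (x∙yz≈y∙xz _ _ _)

lemma3p16 : ∀ {s ℓ} (R : CommutativeSemiring s ℓ) (n : ℕ) (C : LCode n)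
              (σC? : Decidable (σ C)) (u v : CommutativeSemiring.Carrier R) →
            let open CommutativeSemiring R
                open Enumerators R
                two = 1# + 1#
            in W (σ C) σC? u v ≈ swe C (u * u + v * v) (two * (u * v)) (two * (v * v))
lemma3p16 R n C σC? u v = begin
  W (σ C) σC? u v
    ≈⟨ sum-filter σC? Kwords _ ⟩
  ∑[ e ∈ Kwords ] 𝟙 (σC? e) * (pow u (n *ℕ 2 ∸ wt e) * pow v (wt e))
    ≈⟨ sum-cong Kwords (λ e → *-congˡ (wt-monomial e)) ⟩
  ∑[ e ∈ Kwords ] 𝟙 (σC? e) * monK e
    ≈⟨ sum-cong Kwords (λ e → σ-indicator C σC? e (monK e)) ⟩
  ∑[ e ∈ Kwords ] onJust (decode n e) (λ x → 𝟙 (member? C x) * monK e)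
    ≈⟨ pushforward n (λ x → 𝟙 (member? C x)) ⟩
  ∑[ x ∈ Lwords ] 𝟙 (member? C x) * monL x
    ≈⟨ sum-cong Lwords (λ x → *-congˡ (≈-sym (swe-monomial x))) ⟩
  ∑[ x ∈ Lwords ] 𝟙 (member? C x) * (pow (λL 0L) (n0 x) * (pow (λL 1L) (n1 x) * pow (λL ω) (n2 x)))
    ≈⟨ ≈-sym (sum-filter (member? C) Lwords _) ⟩
  swe C (λL 0L) (λL 1L) (λL ω) ∎
  where
  open CommutativeSemiring R using (_≈_; _*_; *-congˡ; setoid) renaming (sym to ≈-sym)
  open import Relation.Binary.Reasoning.Setoid setoid
  open Enumerators R
  open Enumeration R
  open Monomials u v
  Kwords : List (Vec K (n *ℕ 2))
  Kwords = allVecs allK (n *ℕ 2)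
  Lwords : List (Vec L n)
  Lwords = allVecs allL n
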